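{- Let $\mathcal{F}=\langle E,H,\sim\rangle$ be an ETL frame in which $\sim$ is transitive and Euclidean and which has $\mathsf{PR_{hc}^\ell}$. Let $h_1,h_2',h,h_2$ be histories with $h_2'\preceq h\preceq h_2$. If $h_1\sim h_2$ and $h_1\sim h_2'$, then $h_1\,\dot\sim\, h$, where $\dot\sim$ is the smallest equivalence relation on $H$ containing $\sim$.
   Context: Fix a finite set $E$ of events; histories are finite sequences of events. Write $h\leadsto h'$ if $h'=he$ for some event $e$; $\preceq$ is the prefix relation (reflexive–transitive closure of $\leadsto$). A protocol $H$ is a finite prefix-closed set of histories. An ETL frame is $\langle E,H,\sim\rangle$ with $\sim\subseteq H\times H$. Euclidean: $h\sim h'$ and $h\sim h''$ imply $h'\sim h''$. $\mathsf{PR_{hc}^\ell}$: for all $h,h'$ and events $e$ with $he\sim h'$: (i) $h\sim h'$, or (ii) $h\sim h''\leadsto h'$ for some $h''$, or (iii) $he\sim h''\leadsto h'$ for some $h''$. -}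

module Defs where

open import Data.Nat using (ℕ)
open import Data.Fin using (Fin)
open import Data.List using (List; _++_; [_])
open import Data.List.Membership.Propositional using (_∈_)
open import Data.Product using (Σ; ∃; ∃-syntax; _×_; _,_)
open import Data.Sum using (_⊎_)
open import Level using (Level; _⊔_; suc)
open import Relation.Binary.PropositionalEquality using (_≡_)

History : ℕ → Set
History n = List (Fin n)

_↝_ : ∀ {n} → History n → History n → Set
h ↝ h' = ∃[ e ] h' ≡ h ++ [ e ]

data _⪯_ {n : ℕ} : History n → History n → Set where
  ⪯-refl : ∀ {h} → h ⪯ h
  ⪯-step : ∀ {h h' h''} → h ⪯ h' → h' ↝ h'' → h ⪯ h''

record ETLFrame (n : ℕ) : Set₁ where
  field
    H : History n → Set
    enum : List (History n)
    finite : ∀ {h} → H h → h ∈ enum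
    prefix-closed : ∀ {h h'} → h ⪯ h' → H h' → H h
    _∼_ : History n → History n → Set
    ∼⊆H×H : ∀ {h h'} → h ∼ h' → H h × H h'

module _ {n : ℕ} (F : ETLFrame n) where
  open ETLFrame F

  Transitive∼ : Set
  Transitive∼ = ∀ {h h' h''} → h ∼ h' → h' ∼ h'' → h ∼ h''

  Euclidean∼ : Set
  Euclidean∼ = ∀ {h h' h''} → h ∼ h' → h ∼ h'' → h' ∼ h''

  PRhcℓ : Set
  PRhcℓ = ∀ (h h' : History n) (e : Fin n) → (h ++ [ e ]) ∼ h' →
            (h ∼ h')
            ⊎ (∃[ h'' ] (h ∼ h'' × h'' ↝ h'))
            ⊎ (∃[ h'' ] ((h ++ [ e ]) ∼ h'' × h'' ↝ h'))

  data _∼̇_ : History n → History n → Set where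
    incl  : ∀ {h h'} → h ∼ h' → h ∼̇ h'
    refl∼̇ : ∀ {h} → H h → h ∼̇ h
    sym∼̇  : ∀ {h h'} → h ∼̇ h' → h' ∼̇ h
    trans∼̇ : ∀ {h h' h''} → h ∼̇ h' → h' ∼̇ h'' → h ∼̇ h''

-- Call a history u down-closed if u ∼ v implies w ∼ v for every w between v and u.
-- Every history is down-closed, by well-founded induction along ↝: for u = k e, the
-- relation k e ∼ v is first pushed back to k ∼ v (the only place PR_hc^ℓ is used),
-- and then the down-closure of the shorter history k finishes the job. The theorem
-- follows since h₂ ∼ h₂′ by Euclideanity, hence h ∼ h₂′, and h₁ ∼ h₂′.
module Submission where

open import Defs
open import Data.Nat using (ℕ; _<_; s≤s; z≤n)
open import Data.Nat.Induction using (<-wellFounded)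
open import Data.Nat.Properties using (m<m+n)
open import Data.List using (List; length; _++_; [_])
open import Data.List.Properties using (length-++)
open import Data.Fin using (Fin)
open import Data.Product using (_,_)
open import Data.Sum using (inj₁; inj₂)
open import Induction.WellFounded using (WellFounded; Acc; acc; module Subrelation)
open import Relation.Binary.Construct.On as On using ()
open import Relation.Binary.PropositionalEquality using (refl)

module _ {n : ℕ} where

  ⪯-trans : {u v w : History n} → u ⪯ v → v ⪯ w → u ⪯ w
  ⪯-trans p ⪯-refl         = p
  ⪯-trans p (⪯-step q s) = ⪯-step (⪯-trans p q) s

  ↝⇒⪯ : {u v : History n} → u ↝ v → u ⪯ v
  ↝⇒⪯ = ⪯-step ⪯-refl

  ↝⇒length< : {u v : History n} → u ↝ v → length u < length v
  ↝⇒length< {u} (e , refl) rewrite length-++ u {[ e ]} = m<m+n (length u) (s≤s z≤n)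

  ↝-wellFounded : WellFounded (_↝_ {n})
  ↝-wellFounded = Subrelation.wellFounded ↝⇒length< (On.wellFounded length <-wellFounded)

module _ {n : ℕ} (F : ETLFrame n) (trans : Transitive∼ F) (eucl : Euclidean∼ F) (pr : PRhcℓ F) where
  open ETLFrame F

  DownClosed : History n → Set
  DownClosed u = ∀ {v w} → u ∼ v → v ⪯ w → w ⪯ u → w ∼ v

  ∼-retreat : ∀ {k e w} → DownClosed k → Acc _↝_ w → w ⪯ k → (k ++ [ e ]) ∼ w → k ∼ w
  ∼-retreat {k} {e} {w} closed (acc rec) w⪯k ke∼w with pr k w e ke∼w
  ... | inj₁ k∼w = k∼w
  -- closure of k gives w ∼ w⁻; it flips to w⁻ ∼ w because w ∼ w (Euclidean on k e ∼ w).
  ... | inj₂ (inj₁ (w⁻ , k∼w⁻ , w⁻↝w)) =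
    trans k∼w⁻ (eucl (closed k∼w⁻ (↝⇒⪯ w⁻↝w) w⪯k) (eucl ke∼w ke∼w))
  ... | inj₂ (inj₂ (w⁻ , ke∼w⁻ , w⁻↝w)) =
    trans (∼-retreat closed (rec w⁻↝w) (⪯-trans (↝⇒⪯ w⁻↝w) w⪯k) ke∼w⁻) (eucl ke∼w⁻ ke∼w)

  downClosed-acc : ∀ {u} → Acc _↝_ u → DownClosed u
  downClosed-acc _ u∼v _ ⪯-refl = u∼v
  downClosed-acc (acc rec) {v} u∼v v⪯w (⪯-step {h' = k} w⪯k (e , refl)) =
    closedₖ (∼-retreat closedₖ (↝-wellFounded v) (⪯-trans v⪯w w⪯k) u∼v) v⪯w w⪯k
    where
      closedₖ : DownClosed k
      closedₖ = downClosed-acc (rec (e , refl))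

  downClosed : ∀ u → DownClosed u
  downClosed u = downClosed-acc (↝-wellFounded u)

lemma2 : ∀ {n : ℕ} (F : ETLFrame n) → Transitive∼ F → Euclidean∼ F → PRhcℓ F →
    ∀ (h₁ h₂′ h h₂ : List (Fin n)) → ETLFrame.H F h₁ → ETLFrame.H F h₂′ → ETLFrame.H F h → ETLFrame.H F h₂ →
    h₂′ ⪯ h → h ⪯ h₂ →
    ETLFrame._∼_ F h₁ h₂ → ETLFrame._∼_ F h₁ h₂′ →
    _∼̇_ F h₁ h
lemma2 F trans eucl pr h₁ h₂′ h h₂ _ _ _ _ h₂′⪯h h⪯h₂ h₁∼h₂ h₁∼h₂′ =
  trans∼̇ (incl h₁∼h₂′) (sym∼̇ (incl h∼h₂′))
  where
    h∼h₂′ : ETLFrame._∼_ F h h₂′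
    h∼h₂′ = downClosed F trans eucl pr h₂ (eucl h₁∼h₂ h₁∼h₂′) h₂′⪯h h⪯h₂
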